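{- Let $p\ge0$. The graph $C_5+p$, obtained from the $5$-cycle $C_5$ by adding $p$ universal vertices, is a projective core.
   Context: Graphs are finite, simple, undirected, loopless. Formally $C_5+p$ has vertex set $V_{C_5}\uplus V_{K_p}$ and edge set $E_{C_5}\cup E_{K_p}$ together with all edges between $V_{C_5}$ and $V_{K_p}$ (the added $p$ vertices are pairwise adjacent and adjacent to all vertices of $C_5$). $H$ is a core if every homomorphism $H\to H$ is bijective. A polymorphism $f:V_H^m\to V_H$ is a homomorphism $H^m\to H$ (direct product); it is idempotent if $f(x,\dots,x)=x$. $H$ is projective if every idempotent polymorphism is a projection. -}

module Defs where

open import Data.Nat using (ℕ; suc)
open import Data.Fin using (Fin; zero; suc)
open import Data.Fin.Properties using (_≟_)
open import Data.Sum using (_⊎_; inj₁; inj₂)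
open import Data.Product using (Σ; _×_; ∃)
open import Data.Vec using (Vec; lookup; replicate)
open import Data.Vec.Relation.Unary.All using (All)
open import Data.Vec.Relation.Binary.Pointwise.Inductive using (Pointwise)
open import Data.Empty using (⊥)
open import Data.Unit using (⊤)
open import Relation.Binary.PropositionalEquality using (_≡_)
open import Relation.Nullary using (¬_)
open import Function.Definitions using (Bijective)

record Graph : Set₁ where
  field
    size : ℕ
    Adj  : Fin size → Fin size → Set
    sym  : ∀ {x y} → Adj x y → Adj y x
    irr  : ∀ {x} → ¬ Adj x x

open Graph public

V : Graph → Set
V H = Fin (size H)

IsHom : (G H : Graph) → (V G → V H) → Set
IsHom G H f = ∀ {x y} → Adj G x y → Adj H (f x) (f y)

IsCore : Graph → Set
IsCore H = (f : V H → V H) → IsHom H H f → Bijective _≡_ _≡_ f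

AdjPow : (H : Graph) (m : ℕ) → Vec (V H) m → Vec (V H) m → Set
AdjPow H m xs ys = Pointwise (Adj H) xs ys

IsPolymorphism : (H : Graph) (m : ℕ) → (Vec (V H) m → V H) → Set
IsPolymorphism H m f = ∀ {xs ys} → AdjPow H m xs ys → Adj H (f xs) (f ys)

IsIdempotent : (H : Graph) (m : ℕ) → (Vec (V H) m → V H) → Set
IsIdempotent H m f = ∀ x → f (replicate m x) ≡ x

IsProjection : (H : Graph) (m : ℕ) → (Vec (V H) m → V H) → Set
IsProjection H m f = Σ (Fin m) λ i → ∀ xs → f xs ≡ lookup xs i

IsProjective : Graph → Set
IsProjective H = (m : ℕ) (f : Vec (V H) m → V H) →
  IsPolymorphism H m f → IsIdempotent H m f → IsProjection H m f

c5succ : Fin 5 → Fin 5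
c5succ zero = suc zero
c5succ (suc zero) = suc (suc zero)
c5succ (suc (suc zero)) = suc (suc (suc zero))
c5succ (suc (suc (suc zero))) = suc (suc (suc (suc zero)))
c5succ (suc (suc (suc (suc zero)))) = zero

C5Adj : Fin 5 → Fin 5 → Set
C5Adj i j = (j ≡ c5succ i) ⊎ (i ≡ c5succ j)

-- Vertices of C5+p: Fin (5 + p); the first 5 (via inject+) form the C5,
-- the last p (via raise 5) are the added universal vertices.
open import Data.Fin using (splitAt)
open import Data.Nat using (_+_)

C5pAdj' : ∀ p → Fin 5 ⊎ Fin p → Fin 5 ⊎ Fin p → Set
C5pAdj' p (inj₁ i) (inj₁ j) = C5Adj i j
C5pAdj' p (inj₁ i) (inj₂ b) = ⊤
C5pAdj' p (inj₂ a) (inj₁ j) = ⊤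
C5pAdj' p (inj₂ a) (inj₂ b) = ¬ (a ≡ b)

C5pAdj : ∀ p → Fin (5 + p) → Fin (5 + p) → Set
C5pAdj p x y = C5pAdj' p (splitAt 5 x) (splitAt 5 y)

private
  sym' : ∀ p {x y} → C5pAdj' p x y → C5pAdj' p y x
  sym' p {inj₁ i} {inj₁ j} (inj₁ e) = inj₂ e
  sym' p {inj₁ i} {inj₁ j} (inj₂ e) = inj₁ e
  sym' p {inj₁ i} {inj₂ b} _ = _
  sym' p {inj₂ a} {inj₁ j} _ = _
  sym' p {inj₂ a} {inj₂ b} ne e = ne (Relation.Binary.PropositionalEquality.sym e)

  irrC5 : ∀ i → ¬ C5Adj i i
  irrC5 zero (inj₁ ())
  irrC5 zero (inj₂ ())
  irrC5 (suc zero) (inj₁ ())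
  irrC5 (suc zero) (inj₂ ())
  irrC5 (suc (suc zero)) (inj₁ ())
  irrC5 (suc (suc zero)) (inj₂ ())
  irrC5 (suc (suc (suc zero))) (inj₁ ())
  irrC5 (suc (suc (suc zero))) (inj₂ ())
  irrC5 (suc (suc (suc (suc zero)))) (inj₁ ())
  irrC5 (suc (suc (suc (suc zero)))) (inj₂ ())

  irr' : ∀ p x → ¬ C5pAdj' p x x
  irr' p (inj₁ i) = irrC5 i
  irr' p (inj₂ a) ne = ne Relation.Binary.PropositionalEquality.refl

C5+ : ℕ → Graph
C5+ p = record
  { size = 5 + p
  ; Adj  = C5pAdj p
  ; sym  = λ {x} {y} → sym' p {splitAt 5 x} {splitAt 5 y}
  ; irr  = λ {x} → irr' p (splitAt 5 x)
  }

-- An idempotent polymorphism F of C5+p maps vectors of cycle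
-- vertices into the cycle, since by idempotency the image is adjacent to every apex. Its
-- restriction to the cycle is an idempotent polymorphism of C5; as any two distinct vertices
-- of C5 are joined by a walk of length 3 and C5 has no triangle, it is even a polymorphism of
-- K5, hence a projection by the decisive-coalition argument of Arrow's theorem. The
-- projection extends to all of C5+p: no neighbourhood in C5+p contains another, and F vs is
-- adjacent to every neighbour of the chosen coordinate of vs.
--
-- Only two cycle vertices at distance two are distinct and non-adjacent.
-- Identifying them turns the rest of the cycle into a triangle that, together with the
-- images of the apices, is a clique on p + 3 vertices; but pigeonholing with two colourings
-- by p + 2 colours shows that cliques of C5+p have at most p + 2 vertices.

module Submission where

open import Defs hiding (sym)
open import Data.Bool using (Bool; true; false; T; not; if_then_else_)
open import Data.Bool.Properties using (if-not)
open import Data.Empty using (⊥; ⊥-elim)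
open import Data.Fin using (Fin; zero; suc; toℕ; fromℕ<; splitAt; join; _↑ˡ_; _↑ʳ_; punchOut; #_)
open import Data.Fin.Properties
  using (_≟_; all?; any?; toℕ-injective; toℕ-fromℕ<; toℕ<n; splitAt-↑ˡ; splitAt-↑ʳ; splitAt⁻¹-↑ˡ; splitAt⁻¹-↑ʳ;
         join-splitAt; ↑ˡ-injective; ↑ʳ-injective; pigeonhole; <⇒≢; punchOut-injective; injective⇒≤)
open import Data.Nat as ℕ using (ℕ; zero; suc; _+_; _∸_; _%_; _≤_; _<_; s≤s⁻¹)
open import Data.Nat.DivMod using (_mod_)
open import Data.Nat.Properties using (<-cmp; <⇒≤; <⇒≱; ≤-refl; n<1+n; 1+n≰n)
open import Data.Product using (∃; ∃₂; _×_; _,_)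
open import Data.Sum using (_⊎_; inj₁; inj₂; [_,_]′; swap; map₁)
open import Data.Unit using (tt)
open import Data.Vec using (Vec; []; _∷_; lookup; replicate; tabulate; map; _[_]≔_)
open import Data.Vec.Properties
  using (lookup∘tabulate; lookup-replicate; tabulate-cong; lookup-map; map-replicate; map-[]≔;
         lookup∘update; lookup∘update′)
open import Data.Vec.Relation.Binary.Pointwise.Inductive using (Pointwise; []; _∷_; map⁺)
open import Data.Vec.Relation.Binary.Pointwise.Extensional using (ext; extensional⇒inductive)
open import Function using (_∘_; id; const)
open import Function.Definitions using (Injective; Surjective)
open import Relation.Binary using (tri<; tri≈; tri>)
open import Relation.Binary.PropositionalEquality
  using (_≡_; _≢_; refl; sym; trans; cong; subst; subst₂; module ≡-Reasoning)
open import Relation.Nullary using (¬_; yes; no; Dec)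
open import Relation.Nullary.Decidable using (⌊_⌋; toWitness; fromWitness; from-yes; ¬?; _×-dec_; _⊎-dec_; _→-dec_)

splitAt-injective : ∀ m {n} {i j : Fin (m + n)} → splitAt m i ≡ splitAt m j → i ≡ j
splitAt-injective m {n} {i} {j} e =
  trans (sym (join-splitAt m n i)) (trans (cong (join m n) e) (join-splitAt m n j))

↑ˡ≢↑ʳ : ∀ {m n} {i : Fin m} {j : Fin n} → i ↑ˡ n ≢ m ↑ʳ j
↑ˡ≢↑ʳ {m} {n} {i} {j} e with trans (sym (splitAt-↑ˡ m i n)) (trans (cong (splitAt m) e) (splitAt-↑ʳ m n j))
... | ()

injective⇒surjective : ∀ {n} {f : Fin n → Fin n} → Injective _≡_ _≡_ f → Surjective _≡_ _≡_ f
injective⇒surjective {zero} _ ()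
injective⇒surjective {suc n} {f} f-inj y with any? (λ x → f x ≟ y)
... | yes (x , fx≡y) = x , λ { refl → fx≡y }
... | no ∄x = ⊥-elim (1+n≰n (injective⇒≤ f-punchOut-injective))
  where
  f-punchOut-injective : Injective _≡_ _≡_ (λ x → punchOut {i = y} {j = f x} (λ y≡fx → ∄x (x , sym y≡fx)))
  f-punchOut-injective e = f-inj (punchOut-injective {i = y} _ _ e)

adj-coordinates⇒adj : ∀ G {m} F → IsPolymorphism G m F → IsIdempotent G m F →
                      ∀ vs w → (∀ i → Adj G (lookup vs i) w) → Adj G (F vs) w
adj-coordinates⇒adj G F pol idem vs w vs~w = subst (Adj G (F vs)) (idem w)
  (pol (extensional⇒inductive (ext λ i → subst (Adj G (lookup vs i)) (sym (lookup-replicate i w)) (vs~w i))))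

adj⇒≢ : ∀ G {x y} → Adj G x y → x ≢ y
adj⇒≢ G x~x refl = irr G x~x

IsClique : ∀ G {n} → (Fin n → V G) → Set
IsClique G q = ∀ {i j} → i ≢ j → Adj G (q i) (q j)

triangle-clique : ∀ G {x y z} → Adj G x y → Adj G y z → Adj G z x → IsClique G (lookup (x ∷ y ∷ z ∷ []))
triangle-clique G x~y y~z z~x {zero}             {suc zero}       _ = x~y
triangle-clique G x~y y~z z~x {zero}             {suc (suc zero)} _ = Graph.sym G z~x
triangle-clique G x~y y~z z~x {suc zero}         {zero}           _ = Graph.sym G x~y
triangle-clique G x~y y~z z~x {suc zero}         {suc (suc zero)} _ = y~z
triangle-clique G x~y y~z z~x {suc (suc zero)}   {zero}           _ = z~x
triangle-clique G x~y y~z z~x {suc (suc zero)}   {suc zero}       _ = Graph.sym G y~z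
triangle-clique G x~y y~z z~x {zero}             {zero}           i≢i = ⊥-elim (i≢i refl)
triangle-clique G x~y y~z z~x {suc zero}         {suc zero}       i≢i = ⊥-elim (i≢i refl)
triangle-clique G x~y y~z z~x {suc (suc zero)}   {suc (suc zero)} i≢i = ⊥-elim (i≢i refl)

join-clique : ∀ G {s t} {q : Fin s → V G} {r : Fin t → V G} → IsClique G q → IsClique G r →
              (∀ a b → Adj G (q a) (r b)) → IsClique G ([ q , r ]′ ∘ splitAt s)
join-clique G {s} q-clique r-clique q~r {i} {j} i≢j with splitAt s i in ei | splitAt s j in ej
... | inj₁ a | inj₁ b = q-clique λ { refl → i≢j (splitAt-injective s (trans ei (sym ej))) }
... | inj₁ a | inj₂ b = q~r a b
... | inj₂ a | inj₁ b = Graph.sym G (q~r b a)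
... | inj₂ a | inj₂ b = r-clique λ { refl → i≢j (splitAt-injective s (trans ei (sym ej))) }

-- Idempotent polymorphisms of complete graphs

Complete : ℕ → Graph
Complete n = record
  { size = n
  ; Adj  = _≢_
  ; sym  = λ x≢y y≡x → x≢y (sym y≡x)
  ; irr  = λ x≢x → x≢x refl
  }

avoid-zero : ∀ {k} (b : Fin (3 + k)) → ∃ λ c → c ≢ zero × c ≢ b
avoid-zero b with suc zero ≟ b
... | no 1≢b   = suc zero , (λ ()) , 1≢b
... | yes refl = suc (suc zero) , (λ ()) , (λ ())

avoid-pair : ∀ {k} (a b : Fin (3 + k)) → ∃ λ c → c ≢ a × c ≢ b
avoid-pair a b with zero ≟ a | zero ≟ b
... | yes refl | _        = avoid-zero b
... | no 0≢a   | yes refl = let c , c≢0 , c≢a = avoid-zero a in c , c≢a , c≢0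
... | no 0≢a   | no 0≢b   = zero , 0≢a , 0≢b

module CompleteProjective {k m : ℕ} (f : Vec (Fin (3 + k)) m → Fin (3 + k))
  (pol : IsPolymorphism (Complete (3 + k)) m f) (idem : IsIdempotent (Complete (3 + k)) m f) where

  Coalition : Set
  Coalition = Fin m → Bool

  _⊆_ : Coalition → Coalition → Set
  X ⊆ Y = ∀ i → T (X i) → T (Y i)

  split : Fin (3 + k) → Fin (3 + k) → Coalition → Vec (Fin (3 + k)) m
  split a b X = tabulate λ i → if X i then a else b

  ⊆-refl : ∀ {X} → X ⊆ X
  ⊆-refl _ x = x

  lookup-split : ∀ a b X i → lookup (split a b X) i ≡ (if X i then a else b)
  lookup-split a b X = lookup∘tabulate (λ i → if X i then a else b)

  Decisive : Coalition → Set
  Decisive X = ∀ {a b} → a ≢ b → f (split a b X) ≡ a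

  pointwise-≢⇒≢ : ∀ {xs ys : Vec (Fin (3 + k)) m} → (∀ i → lookup xs i ≢ lookup ys i) → f xs ≢ f ys
  pointwise-≢⇒≢ h = pol (extensional⇒inductive (ext h))

  avoids⇒≢ : ∀ {xs d} → (∀ i → lookup xs i ≢ d) → f xs ≢ d
  avoids⇒≢ {xs} {d} h fxs≡d =
    pointwise-≢⇒≢ (λ i e → h i (trans e (lookup-replicate i d))) (trans fxs≡d (sym (idem d)))

  split-conservative : ∀ a b X → f (split a b X) ≡ a ⊎ f (split a b X) ≡ b
  split-conservative a b X with f (split a b X) ≟ a | f (split a b X) ≟ b
  ... | yes e | _     = inj₁ e
  ... | no _  | yes e = inj₂ e
  ... | no ≢a | no ≢b = ⊥-elim (avoids⇒≢ avoids refl)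
    where
    avoids : ∀ i → lookup (split a b X) i ≢ f (split a b X)
    avoids i rewrite lookup-split a b X i with X i
    ... | true  = ≢a ∘ sym
    ... | false = ≢b ∘ sym

  -- split a b X and split c a Y differ in every coordinate, so f cannot send both to a.
  decisive-transfer : ∀ {a b c X Y} → a ≢ b → c ≢ a → c ≢ b → X ⊆ Y →
                      f (split a b X) ≡ a → f (split c a Y) ≡ c
  decisive-transfer {a} {b} {c} {X} {Y} a≢b c≢a c≢b X⊆Y fX≡a with split-conservative c a Y
  ... | inj₁ fY≡c = fY≡c
  ... | inj₂ fY≡a = ⊥-elim (pointwise-≢⇒≢ apart (trans fX≡a (sym fY≡a)))
    where
    apart : ∀ i → lookup (split a b X) i ≢ lookup (split c a Y) i
    apart i rewrite lookup-split a b X i | lookup-split c a Y i with X i | Y i | X⊆Y i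
    ... | true  | true  | _  = c≢a ∘ sym
    ... | true  | false | ⊆i = λ _ → ⊆i tt
    ... | false | true  | _  = c≢b ∘ sym
    ... | false | false | _  = a≢b ∘ sym

  decisive-from-pivot : ∀ {d X} → (∀ {e} → e ≢ d → f (split e d X) ≡ e) → Decisive X
  decisive-from-pivot {d} {X} h {a} {b} a≢b with b ≟ d | a ≟ d
  ... | yes refl | _        = h a≢b
  ... | no b≢d   | no a≢d   = decisive-transfer b≢d a≢b a≢d ⊆-refl (h b≢d)
  ... | no b≢d   | yes refl =
    let e , e≢d , e≢b = avoid-pair d b
        fb = decisive-transfer e≢d (e≢b ∘ sym) b≢d ⊆-refl (h e≢d)
    in  decisive-transfer (e≢b ∘ sym) a≢b (e≢d ∘ sym) ⊆-refl fb

  decisive-mono : ∀ {X Y} → Decisive X → X ⊆ Y → Decisive Y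
  decisive-mono dX X⊆Y {a} {b} a≢b =
    let e , e≢a , e≢b = avoid-pair a b
    in  decisive-transfer (e≢b ∘ sym) a≢b (e≢a ∘ sym) X⊆Y (dX (e≢b ∘ sym))

  ∁ : Coalition → Coalition
  ∁ X = not ∘ X

  ¬decisive-∁ : ∀ {X} → Decisive X → Decisive (∁ X) → ⊥
  ¬decisive-∁ {X} dX d∁X = 0≢1 (begin
    zero                                ≡⟨ sym (d∁X 0≢1) ⟩
    f (split zero (suc zero) (∁ X))      ≡⟨ cong f (tabulate-cong λ i → if-not (X i)) ⟩
    f (split (suc zero) zero X)          ≡⟨ dX (0≢1 ∘ sym) ⟩
    suc zero                            ∎)
    where
    open ≡-Reasoning
    0≢1 : zero ≢ suc zero
    0≢1 ()

  decisive-meet : ∀ {X Y} → Decisive X → Decisive Y → (∀ i → T (X i) → T (Y i) → ⊥) → ⊥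
  decisive-meet {X} {Y} dX dY disjoint = ¬decisive-∁ dY (decisive-mono dX X⊆∁Y)
    where
    X⊆∁Y : X ⊆ ∁ Y
    X⊆∁Y i x with Y i | disjoint i x
    ... | true  | ¬y = ¬y tt
    ... | false | _  = tt

  _⁻¹_ : Vec (Fin (3 + k)) m → Fin (3 + k) → Coalition
  (xs ⁻¹ d) i = ⌊ lookup xs i ≟ d ⌋

  decisive-⁻¹ : ∀ xs → Decisive (xs ⁻¹ f xs)
  decisive-⁻¹ xs = decisive-from-pivot λ {e} e≢d →
    [ id , (λ fe≡d → ⊥-elim (pointwise-≢⇒≢ (apart e≢d) (sym fe≡d))) ]′
      (split-conservative e (f xs) (xs ⁻¹ f xs))
    where
    apart : ∀ {e} → e ≢ f xs → ∀ i → lookup xs i ≢ lookup (split e (f xs) (xs ⁻¹ f xs)) i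
    apart {e} e≢d i rewrite lookup-split e (f xs) (xs ⁻¹ f xs) i with lookup xs i ≟ f xs
    ... | yes x≡d = λ x≡e → e≢d (trans (sym x≡e) x≡d)
    ... | no x≢d  = x≢d

  below : ℕ → Coalition
  below n i = ⌊ toℕ i ℕ.<? n ⌋

  singleton : Fin m → Coalition
  singleton j i = ⌊ i ≟ j ⌋

  rank : ℕ → Fin m → Fin (3 + k)
  rank n i with <-cmp (toℕ i) n
  ... | tri< _ _ _ = suc zero
  ... | tri≈ _ _ _ = zero
  ... | tri> _ _ _ = suc (suc zero)

  rank-zero : ∀ n i → rank n i ≡ zero → toℕ i ≡ n
  rank-zero n i with <-cmp (toℕ i) n
  ... | tri≈ _ i≡n _ = λ _ → i≡n
  ... | tri< _ _ _   = λ ()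
  ... | tri> _ _ _   = λ ()

  rank-one : ∀ n i → rank n i ≡ suc zero → toℕ i < n
  rank-one n i with <-cmp (toℕ i) n
  ... | tri< i<n _ _ = λ _ → i<n
  ... | tri≈ _ _ _   = λ ()
  ... | tri> _ _ _   = λ ()

  rank-other : ∀ n i → rank n i ≢ zero → rank n i ≢ suc zero → n < toℕ i
  rank-other n i with <-cmp (toℕ i) n
  ... | tri> _ _ n<i = λ _ _ → n<i
  ... | tri< _ _ _   = λ _ ≢1 → ⊥-elim (≢1 refl)
  ... | tri≈ _ _ _   = λ ≢0 _ → ⊥-elim (≢0 refl)

  tiers : ℕ → Vec (Fin (3 + k)) m
  tiers n = tabulate (rank n)

  rank≡f-tiers : ∀ n i → T ((tiers n ⁻¹ f (tiers n)) i) → rank n i ≡ f (tiers n)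
  rank≡f-tiers n i x = trans (sym (lookup∘tabulate (rank n) i)) (toWitness x)

  -- In tiers n the coordinate n, the coordinates below it and those above it carry three
  -- distinct values; the value f picks tells which part is decisive.
  decisive-below-suc : ∀ {n} (n<m : n < m) → Decisive (below (suc n)) →
                       Decisive (singleton (fromℕ< n<m)) ⊎ Decisive (below n)
  decisive-below-suc {n} n<m dB with f (tiers n) ≟ zero | f (tiers n) ≟ suc zero
  ... | yes f≡0 | _       = inj₁ (decisive-mono (decisive-⁻¹ (tiers n)) λ i x →
      fromWitness (toℕ-injective (trans (rank-zero n i (trans (rank≡f-tiers n i x) f≡0)) (sym (toℕ-fromℕ< n<m)))))
  ... | no _    | yes f≡1 = inj₂ (decisive-mono (decisive-⁻¹ (tiers n)) λ i x →
      fromWitness (rank-one n i (trans (rank≡f-tiers n i x) f≡1)))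
  ... | no f≢0  | no f≢1  = ⊥-elim (decisive-meet (decisive-⁻¹ (tiers n)) dB λ i x i<1+n →
      <⇒≱ (rank-other n i (f≢0 ∘ trans (sym (rank≡f-tiers n i x))) (f≢1 ∘ trans (sym (rank≡f-tiers n i x))))
          (s≤s⁻¹ (toWitness i<1+n)))

  decisive-singleton : ∀ n → n ≤ m → Decisive (below n) → ∃ λ j → Decisive (singleton j)
  decisive-singleton zero    _   d∅ = ⊥-elim (decisive-meet d∅ d∅ λ i ())
  decisive-singleton (suc n) n<m dB with decisive-below-suc n<m dB
  ... | inj₁ dj = fromℕ< n<m , dj
  ... | inj₂ dn = decisive-singleton n (<⇒≤ n<m) dn

  projection : IsProjection (Complete (3 + k)) m f
  projection with decisive-singleton m ≤-refl
                    (decisive-mono (decisive-⁻¹ (replicate m zero)) λ i _ → fromWitness (toℕ<n i))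
  ... | j , dj = j , f≡lookup
    where
    f≡lookup : ∀ xs → f xs ≡ lookup xs j
    f≡lookup xs with f xs ≟ lookup xs j
    ... | yes e = e
    ... | no ne = ⊥-elim (decisive-meet dj (decisive-⁻¹ xs) λ i i≡j x →
                    ne (sym (trans (cong (lookup xs) (sym (toWitness i≡j))) (toWitness x))))

complete-projective : ∀ k → IsProjective (Complete (3 + k))
complete-projective k m f pol idem = CompleteProjective.projection f pol idem

-- The 5-cycle

c5pred : Fin 5 → Fin 5
c5pred c = c5succ (c5succ (c5succ (c5succ c)))

c5succ-pred : ∀ c → c5succ (c5pred c) ≡ c
c5succ-pred zero                             = refl
c5succ-pred (suc zero)                       = refl
c5succ-pred (suc (suc zero))                 = refl
c5succ-pred (suc (suc (suc zero)))           = refl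
c5succ-pred (suc (suc (suc (suc zero))))     = refl

C5Adj? : ∀ a b → Dec (C5Adj a b)
C5Adj? a b = (b ≟ c5succ a) ⊎-dec (a ≟ c5succ b)

abstract
  C5-irreflexive : ∀ c → ¬ C5Adj c c
  C5-irreflexive = from-yes (all? λ c → ¬? (C5Adj? c c))

  C5-triangle-free : ∀ {a b c} → C5Adj a b → C5Adj b c → ¬ C5Adj c a
  C5-triangle-free {a} {b} {c} =
    from-yes (all? λ a → all? λ b → all? λ c → C5Adj? a b →-dec C5Adj? b c →-dec ¬? (C5Adj? c a)) a b c

  C5-walk₃ : ∀ {a b} → a ≢ b → ∃₂ λ s t → C5Adj a s × C5Adj s t × C5Adj t b
  C5-walk₃ {a} {b} = from-yes (all? λ a → all? λ b →
    ¬? (a ≟ b) →-dec any? λ s → any? λ t → C5Adj? a s ×-dec C5Adj? s t ×-dec C5Adj? t b) a b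

  C5-common-neighbour : ∀ {c d} → C5Adj d (c5succ c) → C5Adj d (c5pred c) → d ≡ c
  C5-common-neighbour {c} {d} = from-yes (all? λ c → all? λ d →
    C5Adj? d (c5succ c) →-dec C5Adj? d (c5pred c) →-dec d ≟ c) c d

  C5-distance : ∀ c d → c ≡ d ⊎ C5Adj c d ⊎ d ≡ c5succ (c5succ c) ⊎ c ≡ c5succ (c5succ d)
  C5-distance = from-yes (all? λ c → all? λ d →
    c ≟ d ⊎-dec C5Adj? c d ⊎-dec d ≟ c5succ (c5succ c) ⊎-dec c ≟ c5succ (c5succ d))

-- Alternates along the path c5succ u, …, c5pred u; the only monochromatic edge is u c5succ u.
pathColouring : Fin 5 → Fin 5 → Fin 2
pathColouring u c = ((toℕ c + 4 ∸ toℕ u) % 5) mod 2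

abstract
  pathColouring-monochromatic : ∀ u {c d} → C5Adj c d → pathColouring u c ≡ pathColouring u d → c ≡ u ⊎ d ≡ u
  pathColouring-monochromatic u {c} {d} = from-yes (all? λ u → all? λ c → all? λ d →
    C5Adj? c d →-dec pathColouring u c ≟ pathColouring u d →-dec (c ≟ u ⊎-dec d ≟ u)) u c d

pointwise-walk₃ : ∀ {m} {xs ys : Vec (Fin 5) m} → Pointwise _≢_ xs ys →
                  ∃₂ λ (zs ws : Vec (Fin 5) m) →
                    Pointwise C5Adj xs zs × Pointwise C5Adj zs ws × Pointwise C5Adj ws ys
pointwise-walk₃ []             = [] , [] , [] , [] , []
pointwise-walk₃ (x≢y ∷ xs≢ys) with C5-walk₃ x≢y | pointwise-walk₃ xs≢ys
... | z , w , xz , zw , wy | zs , ws , xzs , zws , wys = z ∷ zs , w ∷ ws , xz ∷ xzs , zw ∷ zws , wy ∷ wys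

C5 : Graph
C5 = record
  { size = 5
  ; Adj  = C5Adj
  ; sym  = swap
  ; irr  = λ {c} → C5-irreflexive c
  }

C5-polymorphism⇒complete : ∀ {m f} → IsPolymorphism C5 m f → IsPolymorphism (Complete 5) m f
C5-polymorphism⇒complete pol xs≢ys fx≡fy with pointwise-walk₃ xs≢ys
... | zs , ws , xzs , zws , wys =
  C5-triangle-free (pol xzs) (pol zws) (subst (C5Adj _) (sym fx≡fy) (pol wys))

-- The 5-cycle with p apices

module _ (p : ℕ) where

  cyc : Fin 5 → V (C5+ p)
  cyc c = c ↑ˡ p

  apex : Fin p → V (C5+ p)
  apex a = 5 ↑ʳ a

  data Position : V (C5+ p) → Set where
    on-cycle : ∀ c → Position (cyc c)
    on-apex  : ∀ a → Position (apex a)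

  position : ∀ v → Position v
  position v with splitAt 5 v in e
  ... | inj₁ c = subst Position (splitAt⁻¹-↑ˡ e) (on-cycle c)
  ... | inj₂ a = subst Position (splitAt⁻¹-↑ʳ e) (on-apex a)

  adj-splitAt⁺ : ∀ x y {sx sy} → splitAt 5 x ≡ sx → splitAt 5 y ≡ sy → C5pAdj' p sx sy → Adj (C5+ p) x y
  adj-splitAt⁺ x y refl refl x~y = x~y

  adj-splitAt⁻ : ∀ x y {sx sy} → splitAt 5 x ≡ sx → splitAt 5 y ≡ sy → Adj (C5+ p) x y → C5pAdj' p sx sy
  adj-splitAt⁻ x y refl refl x~y = x~y

  cyc-adj⁺ : ∀ c d → C5Adj c d → Adj (C5+ p) (cyc c) (cyc d)
  cyc-adj⁺ c d = adj-splitAt⁺ (cyc c) (cyc d) (splitAt-↑ˡ 5 c p) (splitAt-↑ˡ 5 d p)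

  cyc-adj⁻ : ∀ c d → Adj (C5+ p) (cyc c) (cyc d) → C5Adj c d
  cyc-adj⁻ c d = adj-splitAt⁻ (cyc c) (cyc d) (splitAt-↑ˡ 5 c p) (splitAt-↑ˡ 5 d p)

  cyc-apex-adj : ∀ c a → Adj (C5+ p) (cyc c) (apex a)
  cyc-apex-adj c a = adj-splitAt⁺ (cyc c) (apex a) (splitAt-↑ˡ 5 c p) (splitAt-↑ʳ 5 p a) tt

  apex-cyc-adj : ∀ a c → Adj (C5+ p) (apex a) (cyc c)
  apex-cyc-adj a c = adj-splitAt⁺ (apex a) (cyc c) (splitAt-↑ʳ 5 p a) (splitAt-↑ˡ 5 c p) tt

  apex-adj : ∀ a b → a ≢ b → Adj (C5+ p) (apex a) (apex b)
  apex-adj a b = adj-splitAt⁺ (apex a) (apex b) (splitAt-↑ʳ 5 p a) (splitAt-↑ʳ 5 p b)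

  ⊆-neighbourhood⇒≡ : ∀ {x y} → (∀ w → Adj (C5+ p) x w → Adj (C5+ p) y w) → y ≡ x
  ⊆-neighbourhood⇒≡ {x} {y} N with position x | position y
  ... | on-cycle c | on-cycle d = cong cyc (C5-common-neighbour
          (cyc-adj⁻ d (c5succ c) (N (cyc (c5succ c)) (cyc-adj⁺ c (c5succ c) (inj₁ refl))))
          (cyc-adj⁻ d (c5pred c) (N (cyc (c5pred c)) (cyc-adj⁺ c (c5pred c) (inj₂ (sym (c5succ-pred c)))))))
  ... | on-cycle c | on-apex b  = ⊥-elim (irr (C5+ p) {y} (N (apex b) (cyc-apex-adj c b)))
  ... | on-apex a  | on-cycle d = ⊥-elim (irr (C5+ p) {y} (N (cyc d) (apex-cyc-adj a d)))
  ... | on-apex a  | on-apex b with b ≟ a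
  ...   | yes b≡a = cong apex b≡a
  ...   | no b≢a  = ⊥-elim (irr (C5+ p) {y} (N (apex b) (apex-adj a b (b≢a ∘ sym))))

  colour : Fin 5 → V (C5+ p) → Fin (2 + p)
  colour u v = join 2 p (map₁ (pathColouring u) (splitAt 5 v))

  colour-cyc : ∀ u c → colour u (cyc c) ≡ pathColouring u c ↑ˡ p
  colour-cyc u c = cong (join 2 p ∘ map₁ (pathColouring u)) (splitAt-↑ˡ 5 c p)

  colour-apex : ∀ u a → colour u (apex a) ≡ 2 ↑ʳ a
  colour-apex u a = cong (join 2 p ∘ map₁ (pathColouring u)) (splitAt-↑ʳ 5 p a)

  adj-same-colour : ∀ u {v w} → Adj (C5+ p) v w → colour u v ≡ colour u w →
                    ∃₂ λ c d → v ≡ cyc c × w ≡ cyc d × C5Adj c d × pathColouring u c ≡ pathColouring u d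
  adj-same-colour u {v} {w} v~w e with position v | position w
  ... | on-cycle c | on-cycle d = c , d , refl , refl , cyc-adj⁻ c d v~w ,
          ↑ˡ-injective p _ _ (trans (sym (colour-cyc u c)) (trans e (colour-cyc u d)))
  ... | on-cycle c | on-apex b  = ⊥-elim (↑ˡ≢↑ʳ (trans (sym (colour-cyc u c)) (trans e (colour-apex u b))))
  ... | on-apex a  | on-cycle d = ⊥-elim (↑ˡ≢↑ʳ (trans (sym (colour-cyc u d)) (trans (sym e) (colour-apex u a))))
  ... | on-apex a  | on-apex b  with ↑ʳ-injective 2 a b (trans (sym (colour-apex u a)) (trans e (colour-apex u b)))
  ...   | refl = ⊥-elim (irr (C5+ p) {apex a} v~w)

  clique-contains : (q : Fin (3 + p) → V (C5+ p)) → IsClique (C5+ p) q → ∀ u → ∃ λ i → q i ≡ cyc u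
  clique-contains q q-clique u with pigeonhole (n<1+n (2 + p)) (colour u ∘ q)
  ... | i , j , i<j , same with adj-same-colour u (q-clique (<⇒≢ i<j)) same
  ...   | c , d , qi≡c , qj≡d , c~d , πc≡πd with pathColouring-monochromatic u c~d πc≡πd
  ...     | inj₁ refl = i , qi≡c
  ...     | inj₂ refl = j , qj≡d

  clique-bound : (q : Fin (3 + p) → V (C5+ p)) → ¬ IsClique (C5+ p) q
  clique-bound q q-clique =
    let i , qi≡4 = clique-contains q q-clique (# 4)
        j , qj≡1 = clique-contains q q-clique (# 1)
    in  ¬4~1 (cyc-adj⁻ (# 4) (# 1) (subst₂ (Adj (C5+ p)) qi≡4 qj≡1 (q-clique (distinct qi≡4 qj≡1))))
    where
    ¬4~1 : ¬ C5Adj (# 4) (# 1)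
    ¬4~1 (inj₁ ())
    ¬4~1 (inj₂ ())
    distinct : ∀ {i j} → q i ≡ cyc (# 4) → q j ≡ cyc (# 1) → i ≢ j
    distinct qi≡4 qj≡1 refl with ↑ˡ-injective p (# 4) (# 1) (trans (sym qi≡4) qj≡1)
    ... | ()

  module Endomorphism (g : V (C5+ p) → V (C5+ p)) (hom : IsHom (C5+ p) (C5+ p) g) where

    edge : ∀ x y → Adj (C5+ p) x y → Adj (C5+ p) (g x) (g y)
    edge x y = hom {x} {y}

    -- g (cyc c) = g (cyc (c + 2)) would close the path c+2, c+3, c+4 of the cycle into a
    -- triangle, which together with the images of the apices is a clique of size 3 + p.
    no-collapse : ∀ c → g (cyc c) ≢ g (cyc (c5succ (c5succ c)))
    no-collapse c gc≡gc+2 = clique-bound ([ lookup (x ∷ y ∷ z ∷ []) , g ∘ apex ]′ ∘ splitAt 3)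
      (join-clique (C5+ p) (triangle-clique (C5+ p) x~y y~z z~x)
        (λ {a} {b} a≢b → edge (apex a) (apex b) (apex-adj a b a≢b)) triangle~apex)
      where
      c₂ c₃ c₄ : Fin 5
      c₂ = c5succ (c5succ c)
      c₃ = c5succ c₂
      c₄ = c5pred c
      x y z : V (C5+ p)
      x = g (cyc c₂)
      y = g (cyc c₃)
      z = g (cyc c₄)
      x~y : Adj (C5+ p) x y
      x~y = edge (cyc c₂) (cyc c₃) (cyc-adj⁺ c₂ c₃ (inj₁ refl))
      y~z : Adj (C5+ p) y z
      y~z = edge (cyc c₃) (cyc c₄) (cyc-adj⁺ c₃ c₄ (inj₁ refl))
      z~x : Adj (C5+ p) z x
      z~x = subst (Adj (C5+ p) z) gc≡gc+2 (edge (cyc c₄) (cyc c) (cyc-adj⁺ c₄ c (inj₁ (sym (c5succ-pred c)))))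
      triangle~apex : ∀ i a → Adj (C5+ p) (lookup (x ∷ y ∷ z ∷ []) i) (g (apex a))
      triangle~apex zero             a = edge (cyc c₂) (apex a) (cyc-apex-adj c₂ a)
      triangle~apex (suc zero)       a = edge (cyc c₃) (apex a) (cyc-apex-adj c₃ a)
      triangle~apex (suc (suc zero)) a = edge (cyc c₄) (apex a) (cyc-apex-adj c₄ a)

    hom-injective : Injective _≡_ _≡_ g
    hom-injective {x} {y} gx≡gy with position x | position y
    ... | on-cycle c | on-cycle d with C5-distance c d
    ...   | inj₁ c≡d                = cong cyc c≡d
    ...   | inj₂ (inj₁ c~d)         = ⊥-elim (adj⇒≢ (C5+ p) (edge (cyc c) (cyc d) (cyc-adj⁺ c d c~d)) gx≡gy)
    ...   | inj₂ (inj₂ (inj₁ refl)) = ⊥-elim (no-collapse c gx≡gy)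
    ...   | inj₂ (inj₂ (inj₂ refl)) = ⊥-elim (no-collapse d (sym gx≡gy))
    hom-injective gx≡gy | on-cycle c | on-apex b  =
      ⊥-elim (adj⇒≢ (C5+ p) (edge (cyc c) (apex b) (cyc-apex-adj c b)) gx≡gy)
    hom-injective gx≡gy | on-apex a  | on-cycle d =
      ⊥-elim (adj⇒≢ (C5+ p) (edge (apex a) (cyc d) (apex-cyc-adj a d)) gx≡gy)
    hom-injective gx≡gy | on-apex a  | on-apex b with a ≟ b
    ... | yes a≡b = cong apex a≡b
    ... | no a≢b  = ⊥-elim (adj⇒≢ (C5+ p) (edge (apex a) (apex b) (apex-adj a b a≢b)) gx≡gy)

  -- Apices are sent to the junk value zero.
  toCycle : V (C5+ p) → Fin 5
  toCycle v = [ id , const zero ]′ (splitAt 5 v)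

  toCycle-cyc : ∀ c → toCycle (cyc c) ≡ c
  toCycle-cyc c = cong [ id , const zero ]′ (splitAt-↑ˡ 5 c p)

  adj-apices⇒cyc : ∀ v → (∀ a → Adj (C5+ p) v (apex a)) → v ≡ cyc (toCycle v)
  adj-apices⇒cyc v v~apices with position v
  ... | on-cycle c = cong cyc (sym (toCycle-cyc c))
  ... | on-apex a  = ⊥-elim (irr (C5+ p) {apex a} (v~apices a))

  cycleNeighbour : V (C5+ p) → Fin 5
  cycleNeighbour v = c5succ (toCycle v)

  adj-cycleNeighbour : ∀ v → Adj (C5+ p) v (cyc (cycleNeighbour v))
  adj-cycleNeighbour v with position v
  ... | on-cycle c = subst (λ d → Adj (C5+ p) (cyc c) (cyc (c5succ d))) (sym (toCycle-cyc c))
                       (cyc-adj⁺ c (c5succ c) (inj₁ refl))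
  ... | on-apex a  = apex-cyc-adj a (cycleNeighbour (apex a))

  module Restriction {m} (F : Vec (V (C5+ p)) m → V (C5+ p))
    (pol : IsPolymorphism (C5+ p) m F) (idem : IsIdempotent (C5+ p) m F) where

    restriction : Vec (Fin 5) m → Fin 5
    restriction xs = toCycle (F (map cyc xs))

    F-cycle : ∀ xs → F (map cyc xs) ≡ cyc (restriction xs)
    F-cycle xs = adj-apices⇒cyc (F (map cyc xs)) λ a →
      adj-coordinates⇒adj (C5+ p) F pol idem (map cyc xs) (apex a) λ i →
      subst (λ v → Adj (C5+ p) v (apex a)) (sym (lookup-map i cyc xs)) (cyc-apex-adj (lookup xs i) a)

    restriction-polymorphism : IsPolymorphism C5 m restriction
    restriction-polymorphism {xs} {ys} xs~ys = cyc-adj⁻ (restriction xs) (restriction ys)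
      (subst₂ (Adj (C5+ p)) (F-cycle xs) (F-cycle ys) (pol (map⁺ (λ {c} {d} → cyc-adj⁺ c d) xs~ys)))

    restriction-idempotent : IsIdempotent C5 m restriction
    restriction-idempotent c = begin
      toCycle (F (map cyc (replicate m c)))  ≡⟨ cong (toCycle ∘ F) (map-replicate cyc c m) ⟩
      toCycle (F (replicate m (cyc c)))      ≡⟨ cong toCycle (idem (cyc c)) ⟩
      toCycle (cyc c)                        ≡⟨ toCycle-cyc c ⟩
      c                                      ∎
      where open ≡-Reasoning

    cycle-projection : ∃ λ i₀ → ∀ xs → F (map cyc xs) ≡ cyc (lookup xs i₀)
    cycle-projection =
      let i₀ , restriction≡lookup = complete-projective 2 m restriction
                                      (C5-polymorphism⇒complete restriction-polymorphism) restriction-idempotent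
      in  i₀ , λ xs → trans (F-cycle xs) (cong cyc (restriction≡lookup xs))

  module Lift {m} (F : Vec (V (C5+ p)) m → V (C5+ p))
    (pol : IsPolymorphism (C5+ p) m F) (idem : IsIdempotent (C5+ p) m F)
    (i₀ : Fin m) (F-cycle-projection : ∀ xs → F (map cyc xs) ≡ cyc (lookup xs i₀)) where

    cycleNeighbours : Vec (V (C5+ p)) m → Vec (Fin 5) m
    cycleNeighbours = map cycleNeighbour

    -- A neighbour of vs in the power (C5+ p)^m with i₀-coordinate w (when w ~ vs[i₀]),
    -- all of whose other coordinates lie on the cycle.
    neighbour : Vec (V (C5+ p)) m → V (C5+ p) → Vec (V (C5+ p)) m
    neighbour vs w = map cyc (cycleNeighbours vs) [ i₀ ]≔ w

    lookup-neighbour-i₀ : ∀ vs w → lookup (neighbour vs w) i₀ ≡ w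
    lookup-neighbour-i₀ vs w = lookup∘update i₀ (map cyc (cycleNeighbours vs)) w

    lookup-neighbour : ∀ (P : Fin m → V (C5+ p) → Set) vs w → P i₀ w →
                       (∀ i → P i (cyc (cycleNeighbour (lookup vs i)))) →
                       ∀ i → P i (lookup (neighbour vs w) i)
    lookup-neighbour P vs w Pw Pcyc i with i ≟ i₀
    ... | yes refl = subst (P i₀) (sym (lookup-neighbour-i₀ vs w)) Pw
    ... | no i≢i₀  = subst (P i) (sym (begin
      lookup (neighbour vs w) i                 ≡⟨ lookup∘update′ i≢i₀ (map cyc (cycleNeighbours vs)) w ⟩
      lookup (map cyc (cycleNeighbours vs)) i   ≡⟨ lookup-map i cyc (cycleNeighbours vs) ⟩
      cyc (lookup (cycleNeighbours vs) i)       ≡⟨ cong cyc (lookup-map i cycleNeighbour vs) ⟩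
      cyc (cycleNeighbour (lookup vs i))        ∎)) (Pcyc i)
      where open ≡-Reasoning

    adj-neighbour : ∀ {vs w} → Adj (C5+ p) (lookup vs i₀) w → Pointwise (Adj (C5+ p)) vs (neighbour vs w)
    adj-neighbour {vs} {w} v~w = extensional⇒inductive (ext (lookup-neighbour (λ i u → Adj (C5+ p) (lookup vs i) u)
      vs w v~w (λ i → adj-cycleNeighbour (lookup vs i))))

    F-neighbour-cyc : ∀ vs c → F (neighbour vs (cyc c)) ≡ cyc c
    F-neighbour-cyc vs c = begin
      F (neighbour vs (cyc c))                         ≡⟨ cong F (sym (map-[]≔ cyc (cycleNeighbours vs) i₀)) ⟩
      F (map cyc (cycleNeighbours vs [ i₀ ]≔ c))       ≡⟨ F-cycle-projection (cycleNeighbours vs [ i₀ ]≔ c) ⟩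
      cyc (lookup (cycleNeighbours vs [ i₀ ]≔ c) i₀)   ≡⟨ cong cyc (lookup∘update i₀ (cycleNeighbours vs) c) ⟩
      cyc c                                            ∎
      where open ≡-Reasoning

    -- F sends neighbour vs (apex b) to a vertex adjacent to everything adjacent to apex b:
    -- to the cycle through F-neighbour-cyc, to the other apices by idempotency.
    F-neighbour-apex : ∀ vs b → F (neighbour vs (apex b)) ≡ apex b
    F-neighbour-apex vs b = ⊆-neighbourhood⇒≡ N
      where
      ys : Vec (V (C5+ p)) m
      ys = neighbour vs (apex b)
      N : ∀ w → Adj (C5+ p) (apex b) w → Adj (C5+ p) (F ys) w
      N w b~w with position w
      ... | on-cycle c = subst (Adj (C5+ p) (F ys)) (F-neighbour-cyc ys c) (pol (adj-neighbour
              (subst (λ v → Adj (C5+ p) v (cyc c)) (sym (lookup-neighbour-i₀ vs (apex b))) b~w)))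
      ... | on-apex b′ = adj-coordinates⇒adj (C5+ p) F pol idem ys (apex b′)
              (lookup-neighbour (λ _ u → Adj (C5+ p) u (apex b′)) vs (apex b) b~w
                (λ i → cyc-apex-adj (cycleNeighbour (lookup vs i)) b′))

    F-neighbour : ∀ vs w → F (neighbour vs w) ≡ w
    F-neighbour vs w with position w
    ... | on-cycle c = F-neighbour-cyc vs c
    ... | on-apex b  = F-neighbour-apex vs b

    F-projection : ∀ vs → F vs ≡ lookup vs i₀
    F-projection vs = ⊆-neighbourhood⇒≡ λ w v~w →
      subst (Adj (C5+ p) (F vs)) (F-neighbour vs w) (pol (adj-neighbour v~w))

  C5+-projective : IsProjective (C5+ p)
  C5+-projective m F pol idem =
    let i₀ , F-cycle-projection = Restriction.cycle-projection F pol idem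
    in  i₀ , Lift.F-projection F pol idem i₀ F-cycle-projection

  C5+-core : IsCore (C5+ p)
  C5+-core g hom = hom-injective , injective⇒surjective hom-injective
    where open Endomorphism g hom

theorem4p7 : (p : ℕ) → IsProjective (C5+ p) × IsCore (C5+ p)
theorem4p7 p = C5+-projective p , C5+-core p
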